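{- For $n\in\mathbb{N}$ let $m_n$ be the minimum of $\|\lambda\|_2^2$ over all partitions $\lambda$ of $n$ with $\operatorname{rank}(\lambda)\geq 0$. Then the sequence $(m_n)_{n\in\mathbb{N}}$ is strictly increasing.
   Context: A partition of $n$ is a nonincreasing finite sequence $\lambda=(\lambda_1,\ldots,\lambda_k)$ of positive integers with sum $n$; $\|\lambda\|_2^2=\sum_i\lambda_i^2$; the rank of $\lambda$ is $\lambda_1-k$. -}

module Defs where

open import Data.Nat using (ℕ; zero; suc; _+_; _*_; _≤_; _<_; _≥_)
open import Data.List using (List; []; _∷_; map; length)
open import Data.Nat.ListAction using (sum)
open import Data.List.Relation.Unary.All using (All)
open import Data.List.Relation.Unary.Linked using (Linked)
open import Data.Product using (Σ; _×_)
open import Relation.Binary.PropositionalEquality using (_≡_)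

record IsPartition (n : ℕ) (λs : List ℕ) : Set where
  field
    nonincreasing : Linked _≥_ λs
    positive      : All (λ x → 0 < x) λs
    sums          : sum λs ≡ n

firstPart : List ℕ → ℕ
firstPart []      = 0
firstPart (x ∷ _) = x

-- rank(λ) ≥ 0  ⇔  number of parts k ≤ λ₁
RankNonneg : List ℕ → Set
RankNonneg λs = length λs ≤ firstPart λs

normSq : List ℕ → ℕ
normSq λs = sum (map (λ x → x * x) λs)

IsMinNormSq : ℕ → ℕ → Set
IsMinNormSq n m =
  Σ (List ℕ) (λ μ → IsPartition n μ × RankNonneg μ × normSq μ ≡ m)
  × ((μ : List ℕ) → IsPartition n μ → RankNonneg μ → m ≤ normSq μ)

-- A partition of n has at most n parts, each at most n, so the partitions of n of nonnegative
-- rank form a finite nonempty set and the minimum m_n exists.  For monotonicity, remove one cell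
-- from the last part of a minimiser for n + 1: the first part is unchanged unless there is a single
-- part, and the number of parts does not grow, so the result is a partition of n of nonnegative
-- rank whose squared norm is strictly smaller.

module Submission where

open import Defs
open import Data.Nat using (ℕ; zero; suc; pred; _+_; _*_; _≤_; _≥_; z≤n; s≤s; _<_; _≤?_; _≟_; _≥?_; _<?_)
open import Data.Nat.Properties
open import Data.Nat.ListAction using (sum)
open import Data.List using (List; []; _∷_; [_]; map; length; filter; concatMap; upTo)
open import Data.List.Relation.Unary.All as All using (All; []; _∷_; all?)
open import Data.List.Relation.Unary.All.Properties using (all-filter)
open import Data.List.Relation.Unary.Any as Any using (here; there)
open import Data.List.Relation.Unary.Linked using (Linked; []; [-]; _∷_; linked?)
open import Data.List.Membership.Propositional using (_∈_)
open import Data.List.Membership.Propositional.Properties using (∈-concatMap⁺; ∈-map⁺; ∈-filter⁺; ∈-upTo⁺)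
open import Data.List.Extrema.Nat using (argmin; argmin-all; f[argmin]≤f[xs])
open import Data.Product using (Σ; _×_; _,_; proj₁; proj₂)
open import Data.Empty using (⊥-elim)
open import Relation.Nullary using (Dec)
open import Relation.Nullary.Decidable using (_×-dec_; map′)
open import Relation.Unary using (Decidable)
open import Relation.Binary.PropositionalEquality using (_≡_; refl; sym; trans; cong; subst; module ≡-Reasoning)

private
  variable
    A : Set
    n k x : ℕ
    ms : List ℕ

∃-minimiser : {P : A → Set} (f : A → ℕ) → Decidable P → (xs : List A) → (∀ {y} → P y → y ∈ xs) →
              ∀ {y₀} → P y₀ → Σ A (λ μ → P μ × (∀ y → P y → f μ ≤ f y))
∃-minimiser f P? xs covers {y₀} Py₀ =
  argmin f y₀ candidates , argmin-all f Py₀ (all-filter P? xs) ,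
  λ y Py → All.lookup (f[argmin]≤f[xs] y₀ candidates) (∈-filter⁺ P? (covers Py) Py)
  where
  candidates = filter P? xs

boundedLists : ℕ → List A → List (List A)
boundedLists zero    cs = [ [] ]
boundedLists (suc L) cs = [] ∷ concatMap (λ c → map (c ∷_) (boundedLists L cs)) cs

∈-boundedLists⁺ : ∀ L (cs : List A) {xs} → length xs ≤ L → All (_∈ cs) xs → xs ∈ boundedLists L cs
∈-boundedLists⁺ zero    cs {[]}     _         _          = here refl
∈-boundedLists⁺ (suc L) cs {[]}     _         _          = here refl
∈-boundedLists⁺ (suc L) cs {x ∷ xs} (s≤s len) (x∈cs ∷ xs⊆cs) =
  there (∈-concatMap⁺ (λ c → map (c ∷_) (boundedLists L cs)) (Any.map (λ { refl → ∈-map⁺ (x ∷_) (∈-boundedLists⁺ L cs len xs⊆cs) }) x∈cs))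

length≤sum : All (0 <_) ms → length ms ≤ sum ms
length≤sum []       = z≤n
length≤sum (p ∷ ps) = +-mono-≤ p (length≤sum ps)

all≤sum : ∀ ms → All (_≤ sum ms) ms
all≤sum []       = []
all≤sum (m ∷ ms) = m≤m+n m (sum ms) ∷ All.map (λ le → ≤-trans le (m≤n+m (sum ms) m)) (all≤sum ms)

partition-∈-boundedLists : IsPartition n ms → ms ∈ boundedLists n (upTo (suc n))
partition-∈-boundedLists {ms = ms} p =
  ∈-boundedLists⁺ _ _ (subst (length ms ≤_) sums (length≤sum positive))
                      (All.map (λ le → ∈-upTo⁺ (s≤s (subst (_ ≤_) sums le))) (all≤sum ms))
  where open IsPartition p

isPartition? : ∀ n ms → Dec (IsPartition n ms)
isPartition? n ms =
  map′ (λ (dec , pos , sum≡) → record { nonincreasing = dec ; positive = pos ; sums = sum≡ })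
       (λ p → let open IsPartition p in nonincreasing , positive , sums)
       (linked? _≥?_ ms ×-dec all? (0 <?_) ms ×-dec sum ms ≟ n)

IsRankNonnegPartition : ℕ → List ℕ → Set
IsRankNonnegPartition n ms = IsPartition n ms × RankNonneg ms

isRankNonnegPartition? : ∀ n ms → Dec (IsRankNonnegPartition n ms)
isRankNonnegPartition? n ms = isPartition? n ms ×-dec length ms ≤? firstPart ms

singleton⁺ : ℕ → List ℕ
singleton⁺ zero    = []
singleton⁺ (suc k) = [ suc k ]

sum-singleton⁺ : ∀ k → sum (singleton⁺ k) ≡ k
sum-singleton⁺ zero    = refl
sum-singleton⁺ (suc k) = +-identityʳ (suc k)

normSq-singleton⁺ : ∀ k → normSq (singleton⁺ k) ≡ k * k
normSq-singleton⁺ zero    = refl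
normSq-singleton⁺ (suc k) = +-identityʳ (suc k * suc k)

singleton⁺-nonincreasing : ∀ k → Linked _≥_ (singleton⁺ k)
singleton⁺-nonincreasing zero    = []
singleton⁺-nonincreasing (suc k) = [-]

≥-singleton⁺ : k ≤ x → Linked _≥_ (x ∷ singleton⁺ k)
≥-singleton⁺ {zero}  _   = [-]
≥-singleton⁺ {suc k} k≤x = k≤x ∷ [-]

singleton⁺-positive : ∀ k → All (0 <_) (singleton⁺ k)
singleton⁺-positive zero    = []
singleton⁺-positive (suc k) = s≤s z≤n ∷ []

singleton⁺-rankNonneg : ∀ k → RankNonneg (singleton⁺ k)
singleton⁺-rankNonneg zero    = z≤n
singleton⁺-rankNonneg (suc k) = s≤s z≤n

length-singleton⁺ : ∀ k → length (singleton⁺ k) ≤ 1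
length-singleton⁺ zero    = z≤n
length-singleton⁺ (suc k) = ≤-refl

singleton⁺-isRankNonnegPartition : ∀ k → IsRankNonnegPartition k (singleton⁺ k)
singleton⁺-isRankNonnegPartition k =
  record { nonincreasing = singleton⁺-nonincreasing k
         ; positive      = singleton⁺-positive k
         ; sums          = sum-singleton⁺ k }
  , singleton⁺-rankNonneg k

decLast : List ℕ → List ℕ
decLast []           = []
decLast (x ∷ [])     = singleton⁺ (pred x)
decLast (x ∷ y ∷ ys) = x ∷ decLast (y ∷ ys)

decLast-nonincreasing : ∀ ms → Linked _≥_ ms → Linked _≥_ (decLast ms)
decLast-nonincreasing []           _   = []
decLast-nonincreasing (x ∷ [])     _   = singleton⁺-nonincreasing (pred x)
decLast-nonincreasing (x ∷ y ∷ ys) dec = below-head (y ∷ ys) dec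
  where
  below-head : ∀ {x} ys → Linked _≥_ (x ∷ ys) → Linked _≥_ (x ∷ decLast ys)
  below-head []           _             = [-]
  below-head (y ∷ [])     (y≤x ∷ _)     = ≥-singleton⁺ (≤-trans pred[n]≤n y≤x)
  below-head (y ∷ z ∷ zs) (y≤x ∷ y∷zs) = y≤x ∷ below-head (z ∷ zs) y∷zs

decLast-positive : ∀ ms → All (0 <_) ms → All (0 <_) (decLast ms)
decLast-positive []           _        = []
decLast-positive (x ∷ [])     _        = singleton⁺-positive (pred x)
decLast-positive (x ∷ y ∷ ys) (p ∷ ps) = p ∷ decLast-positive (y ∷ ys) ps

length-decLast : ∀ ms → length (decLast ms) ≤ length ms
length-decLast []           = z≤n
length-decLast (x ∷ [])     = length-singleton⁺ (pred x)
length-decLast (x ∷ y ∷ ys) = s≤s (length-decLast (y ∷ ys))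

decLast-rankNonneg : ∀ ms → RankNonneg ms → RankNonneg (decLast ms)
decLast-rankNonneg []           r = r
decLast-rankNonneg (x ∷ [])     _ = singleton⁺-rankNonneg (pred x)
decLast-rankNonneg (x ∷ y ∷ ys) r = ≤-trans (s≤s (length-decLast (y ∷ ys))) r

suc-sum-decLast : ∀ ms → All (0 <_) (x ∷ ms) → suc (sum (decLast (x ∷ ms))) ≡ sum (x ∷ ms)
suc-sum-decLast {suc x} [] _ = cong suc (trans (sum-singleton⁺ x) (sym (+-identityʳ x)))
suc-sum-decLast {x} (y ∷ ys) (_ ∷ ps) = begin
  suc (x + sum (decLast (y ∷ ys)))  ≡⟨ +-suc x _ ⟨
  x + suc (sum (decLast (y ∷ ys)))  ≡⟨ cong (x +_) (suc-sum-decLast ys ps) ⟩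
  x + sum (y ∷ ys)                  ∎
  where open ≡-Reasoning

normSq-decLast< : ∀ ms → All (0 <_) (x ∷ ms) → normSq (decLast (x ∷ ms)) < normSq (x ∷ ms)
normSq-decLast< {suc x} [] _ = begin-strict
  normSq (singleton⁺ x)  ≡⟨ normSq-singleton⁺ x ⟩
  x * x                  <⟨ *-mono-< (n<1+n x) (n<1+n x) ⟩
  suc x * suc x          ≡⟨ +-identityʳ (suc x * suc x) ⟨
  normSq [ suc x ]       ∎
  where open ≤-Reasoning
normSq-decLast< {x} (y ∷ ys) (_ ∷ ps) = +-monoʳ-< (x * x) (normSq-decLast< ys ps)

decLast-isPartition : IsPartition (suc n) (x ∷ ms) → IsPartition n (decLast (x ∷ ms))
decLast-isPartition {ms = ms} p =
  record { nonincreasing = decLast-nonincreasing _ nonincreasing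
         ; positive      = decLast-positive _ positive
         ; sums          = suc-injective (trans (suc-sum-decLast ms positive) sums) }
  where open IsPartition p

minNormSq : ∀ n → Σ ℕ (IsMinNormSq n)
minNormSq n =
  let μ , (p , r) , minimal = ∃-minimiser normSq (isRankNonnegPartition? n)
                                (boundedLists n (upTo (suc n)))
                                (λ (p , _) → partition-∈-boundedLists p)
                                (singleton⁺-isRankNonnegPartition n)
  in normSq μ , (μ , p , r , refl) , λ ν q s → minimal ν (q , s)

IsMinNormSq-< : ∀ {a b} → IsMinNormSq n a → IsMinNormSq (suc n) b → a < b
IsMinNormSq-< _ (([] , p , _) , _) = ⊥-elim (0≢1+n (IsPartition.sums p))
IsMinNormSq-< {a = a} (_ , minimal) ((x ∷ μ , p , r , refl) , _) = begin-strict
  a                        ≤⟨ minimal _ (decLast-isPartition p) (decLast-rankNonneg (x ∷ μ) r) ⟩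
  normSq (decLast (x ∷ μ)) <⟨ normSq-decLast< μ (IsPartition.positive p) ⟩
  normSq (x ∷ μ)           ∎
  where open ≤-Reasoning

lemma15 : Σ (ℕ → ℕ) (λ m → ((n : ℕ) → IsMinNormSq n (m n)) × ((n : ℕ) → m n < m (suc n)))
lemma15 = (λ n → proj₁ (minNormSq n))
        , (λ n → proj₂ (minNormSq n))
        , λ n → IsMinNormSq-< (proj₂ (minNormSq n)) (proj₂ (minNormSq (suc n)))
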